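{- There exist infinitely many real quadratic number fields $K$, and infinitely many imaginary quadratic number fields $K$, whose ring of integers $\mathcal{O}_K$ contains a nonzero ideal $I$ such that the planar lattice $\Lambda_K(I)$ is well-rounded.
   Context: For a number field $K$ of degree $d$ with real embeddings $\sigma_1,\dots,\sigma_{r_1}$ and $r_2$ pairs of complex conjugate embeddings, choose one embedding $\tau_m$ from each complex pair ($1\le m\le r_2$), so $d=r_1+2r_2$. Define $\sigma:K\to\mathbb{R}^d$ by $\sigma(x)=(\sigma_1(x),\dots,\sigma_{r_1}(x),\Re\tau_1(x),\Im\tau_1(x),\dots,\Re\tau_{r_2}(x),\Im\tau_{r_2}(x))$. For a nonzero fractional ideal $I$ of $\mathcal{O}_K$, $\Lambda_K(I):=\sigma(I)$ is a full-rank lattice in $\mathbb{R}^d$. For a full-rank lattice $\Lambda\subset\mathbb{R}^d$, its minimum is $|\Lambda|=\min\{\|x\|^2: x\in\Lambda\setminus\{0\}\}$ (Euclidean norm), its set of minimal vectors is $S(\Lambda)=\{x\in\Lambda:\|x\|^2=|\Lambda|\}$, and $\Lambda$ is well-rounded (WR) if $S(\Lambda)$ spans $\mathbb{R}^d$. -}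

module Defs where

open import Data.Nat as ℕ using (ℕ; suc)
open import Data.Nat.Divisibility using (_∣_)
open import Data.Integer as ℤ using (ℤ; +_; -[1+_]; ∣_∣)
open import Data.Integer.DivMod using (_%ℕ_)
open import Data.Rational using (ℚ; _/_; 0ℚ; 1ℚ; ½; _+_; _*_; -_; _≤_)
open import Data.Product using (_×_; _,_; ∃; ∃-syntax)
open import Relation.Binary.PropositionalEquality using (_≡_; _≢_)
open import Relation.Nullary using (¬_)

SquareFree : ℤ → Set
SquareFree D = ∀ (p : ℕ) → (p ℕ.* p) ∣ ∣ D ∣ → p ≡ 1

ι : ℤ → ℚ
ι m = m / 1

-- The quadratic field K = ℚ(√D) (D squarefree, D ≠ 0, 1):
-- an element (a , b) represents a + b √D.
K : Set
K = ℚ × ℚ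

0K : K
0K = 0ℚ , 0ℚ

_+K_ : K → K → K
(a , b) +K (c , d) = (a + c) , (b + d)

-K_ : K → K
-K (a , b) = (- a) , (- b)

-- multiplication in ℚ(√D): (a + b√D)(c + d√D) = (ac + D bd) + (ad + bc)√D
mulK : ℤ → K → K → K
mulK D (a , b) (c , d) = ((a * c) + (ι D * (b * d))) , ((a * d) + (b * c))

-- Standard integral basis generator ω of 𝒪_K:
-- ω = (1 + √D)/2 if D ≡ 1 (mod 4), and ω = √D otherwise.
ω : ℤ → K
ω D with D %ℕ 4
... | 1 = ½ , ½
... | _ = 0ℚ , 1ℚ

InOK : ℤ → K → Set
InOK D x = ∃[ m ] ∃[ n ] x ≡ ((ι m , 0ℚ) +K mulK D (ι n , 0ℚ) (ω D))

record IsIdeal (D : ℤ) (I : K → Set) : Set where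
  field
    ⊆OK   : ∀ x → I x → InOK D x
    0∈    : I 0K
    +-closed : ∀ x y → I x → I y → I (x +K y)
    neg-closed : ∀ x → I x → I (-K x)
    mul-closed : ∀ r x → InOK D r → I x → I (mulK D r x)

NonZeroIdeal : ℤ → (K → Set) → Set
NonZeroIdeal D I = IsIdeal D I × ∃[ x ] (I x × x ≢ 0K)

-- Squared Euclidean norm ‖σ(x)‖² of the Minkowski embedding σ : K → ℝ².
-- Real case D > 0:  σ(a+b√D) = (a+b√D , a−b√D), ‖σ x‖² = 2a² + 2D b².
-- Imaginary case D = −(k+1) < 0:  σ(a+b√D) = (a , b√(k+1)), ‖σ x‖² = a² + (k+1) b².
sqNorm : ℤ → K → ℚ
sqNorm (+ n)    (a , b) = ι (+ 2) * ((a * a) + (ι (+ n) * (b * b)))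
sqNorm -[1+ k ] (a , b) = (a * a) + (ι (+ suc k) * (b * b))

-- σ(x), σ(y) are ℝ-linearly independent in ℝ²: det[σ x, σ y] ≠ 0.
-- The determinant equals (−2√D)(ad − bc) (real case) resp. √|D|(ad − bc)
-- (imaginary case), so it is nonzero iff ad − bc ≠ 0.
LinIndep : K → K → Set
LinIndep (a , b) (c , d) = ((a * d) + (- (b * c))) ≢ 0ℚ

IsMinimal : ℤ → (K → Set) → K → Set
IsMinimal D I x = I x × x ≢ 0K × (∀ z → I z → z ≢ 0K → sqNorm D x ≤ sqNorm D z)

-- Λ_K(I) ⊂ ℝ² is well-rounded: S(Λ) spans ℝ², i.e. contains two
-- linearly independent minimal vectors.
WellRounded : ℤ → (K → Set) → Set
WellRounded D I = ∃[ x ] ∃[ y ] (IsMinimal D I x × IsMinimal D I y × LinIndep x y)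

HasWRIdeal : ℤ → Set₁
HasWRIdeal D = ∃[ I ] (NonZeroIdeal D I × WellRounded D I)

{-# OPTIONS --safe #-}
-- For D = m(m + 2h) ≡ 3 (mod 4) the ideal 𝔞 = (2m, m + √D) of ℤ[√D] consists of the m u + t √D with
-- u ≡ t (mod 2), and the squared length of such a vector is a fixed multiple of m²u² + |D| t².  When
-- m² ≤ |D| ≤ 3m² this form is minimal at u = ±1, t = 1, so the independent vectors ±m + √D are minimal
-- and Λ(𝔞) is well-rounded.  The families D = (2q+1)(2q+3) and D = −(2q+3)(2q+7) satisfy this, and
-- it remains to see that such products are squarefree for arbitrarily large q.  The two factors are
-- coprime, and counting, in a window of J² consecutive q, those for which some (2j+3)² with j < J
-- divides a factor (at most about J² / (2j+3)² + 1 each, and Σ 1/(2j+3)² < 1/4) leaves a q for which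
-- no such square divides either factor; both factors being odd and below (2J+3)², they are squarefree.
module Submission where

module Offset where

  open import Data.Nat using (_+_; _≤_; +-rawMagma)
  open import Data.Nat.Properties using (≤″⇒≤)
  open import Algebra.Definitions.RawMagma +-rawMagma using (_,_)
  open import Relation.Binary.PropositionalEquality using (_≡_)

  ≤-offset : ∀ {m n} k → m + k ≡ n → m ≤ n
  ≤-offset k eq = ≤″⇒≤ (k , eq)

module FiniteSums where

  open import Data.Nat
  open import Data.Nat.Properties
  open import Algebra.Properties.CommutativeSemigroup +-commutativeSemigroup using (interchange)
  open import Data.Product using (∃-syntax; _×_; _,_; map₁; map₂)
  open import Data.Sum using (inj₁; inj₂)
  open import Relation.Binary.PropositionalEquality

  Σ : ℕ → (ℕ → ℕ) → ℕ
  Σ zero    f = 0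
  Σ (suc n) f = Σ n f + f n

  Σ-cong : ∀ n {f g} → (∀ i → f i ≡ g i) → Σ n f ≡ Σ n g
  Σ-cong zero    f≡g = refl
  Σ-cong (suc n) f≡g = cong₂ _+_ (Σ-cong n f≡g) (f≡g n)

  Σ-mono-≤ : ∀ n {f g} → (∀ i → i < n → f i ≤ g i) → Σ n f ≤ Σ n g
  Σ-mono-≤ zero    f≤g = z≤n
  Σ-mono-≤ (suc n) f≤g =
    +-mono-≤ (Σ-mono-≤ n (λ i i<n → f≤g i (m<n⇒m<1+n i<n))) (f≤g n (n<1+n n))

  Σ-const : ∀ n c → Σ n (λ _ → c) ≡ n * c
  Σ-const zero    c = refl
  Σ-const (suc n) c = trans (cong (_+ c) (Σ-const n c)) (+-comm (n * c) c)

  Σ-distrib-+ : ∀ n f g → Σ n (λ i → f i + g i) ≡ Σ n f + Σ n g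
  Σ-distrib-+ zero    f g = refl
  Σ-distrib-+ (suc n) f g =
    trans (cong (_+ (f n + g n)) (Σ-distrib-+ n f g)) (interchange (Σ n f) (Σ n g) (f n) (g n))

  Σ-comm : ∀ m n (F : ℕ → ℕ → ℕ) → Σ m (λ i → Σ n (F i)) ≡ Σ n (λ j → Σ m (λ i → F i j))
  Σ-comm zero    n F = sym (trans (Σ-const n 0) (*-zeroʳ n))
  Σ-comm (suc m) n F =
    trans (cong (_+ Σ n (F m)) (Σ-comm m n F)) (sym (Σ-distrib-+ n (λ j → Σ m (λ i → F i j)) (F m)))

  Σ-+ : ∀ m n f → Σ (m + n) f ≡ Σ m f + Σ n (λ i → f (m + i))
  Σ-+ m zero    f = trans (cong (λ k → Σ k f) (+-identityʳ m)) (sym (+-identityʳ (Σ m f)))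
  Σ-+ m (suc n) f = begin
    Σ (m + suc n) f                            ≡⟨ cong (λ k → Σ k f) (+-suc m n) ⟩
    Σ (m + n) f + f (m + n)                    ≡⟨ cong (_+ f (m + n)) (Σ-+ m n f) ⟩
    Σ m f + Σ n (λ i → f (m + i)) + f (m + n)  ≡⟨ +-assoc (Σ m f) _ _ ⟩
    Σ m f + Σ (suc n) (λ i → f (m + i))        ∎
    where open ≡-Reasoning

  Σ-monoˡ-≤ : ∀ f {m n} → m ≤ n → Σ m f ≤ Σ n f
  Σ-monoˡ-≤ f {m} {n} m≤n = subst (λ k → Σ m f ≤ Σ k f) (m+[n∸m]≡n m≤n)
    (subst (Σ m f ≤_) (sym (Σ-+ m (n ∸ m) f)) (m≤m+n (Σ m f) _))

  Σ≡0⇒≡0 : ∀ n f → Σ n f ≡ 0 → ∀ i → i < n → f i ≡ 0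
  Σ≡0⇒≡0 (suc n) f Σ≡0 i i<1+n with m≤n⇒m<n∨m≡n (≤-pred i<1+n)
  ... | inj₁ i<n  = Σ≡0⇒≡0 n f (m+n≡0⇒m≡0 (Σ n f) Σ≡0) i i<n
  ... | inj₂ refl = m+n≡0⇒n≡0 (Σ n f) Σ≡0

  Σ<n⇒∃≡0 : ∀ n f → Σ n f < n → ∃[ i ] (i < n × f i ≡ 0)
  Σ<n⇒∃≡0 (suc n) f Σ<1+n with f n in fn≡
  ... | zero  = n , n<1+n n , fn≡
  ... | suc v = map₂ (map₁ m<n⇒m<1+n) (Σ<n⇒∃≡0 n f Σ<n)
    where
    Σ<n : Σ n f < n
    Σ<n = ≤-trans (s≤s (m≤m+n (Σ n f) v)) (≤-pred (subst (_< suc n) (+-suc (Σ n f) v) Σ<1+n))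

module DivisibleTerms where

  open FiniteSums
  open import Data.Nat
  open import Data.Nat.Properties
  open import Data.Nat.DivMod using (_/_; m≡m%n+[m/n]*n; m%n<n)
  open import Data.Nat.Divisibility using (_∣_; _∣?_; ∣⇒≤; ∣m+n∣m⇒∣n)
  open import Data.Nat.Coprimality using (Coprime; coprime-divisor)
  open import Data.Product using (∃-syntax; _×_; _,_)
  open import Data.Sum using (_⊎_; inj₁; inj₂)
  open import Relation.Nullary using (¬_; Dec; yes; no; contradiction)
  open import Relation.Binary.PropositionalEquality

  𝟙 : {P : Set} → Dec P → ℕ
  𝟙 (yes _) = 1
  𝟙 (no _)  = 0

  𝟙≡0⇒¬ : {P : Set} (P? : Dec P) → 𝟙 P? ≡ 0 → ¬ P
  𝟙≡0⇒¬ (no ¬p) _ = ¬p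

  countDivisible : (L A s n : ℕ) → ℕ
  countDivisible L A s n = Σ n (λ i → 𝟙 (L ∣? A + s * i))

  module _ {L s : ℕ} (L⊥s : Coprime L s) where

    divisible-gap : ∀ {A i j} → i < j → L ∣ A + s * i → L ∣ A + s * j → L ≤ j ∸ i
    divisible-gap {A} {i} {j} i<j L∣i L∣j =
      ∣⇒≤ {{>-nonZero (m<n⇒0<n∸m i<j)}}
          (coprime-divisor L⊥s (∣m+n∣m⇒∣n (subst (L ∣_) split L∣j) L∣i))
      where
      open ≡-Reasoning
      split : A + s * j ≡ A + s * i + s * (j ∸ i)
      split = begin
        A + s * j                 ≡⟨ cong (λ k → A + s * k) (sym (m+[n∸m]≡n (<⇒≤ i<j))) ⟩
        A + s * (i + (j ∸ i))     ≡⟨ cong (A +_) (*-distribˡ-+ s i (j ∸ i)) ⟩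
        A + (s * i + s * (j ∸ i)) ≡⟨ +-assoc A (s * i) (s * (j ∸ i)) ⟨
        A + s * i + s * (j ∸ i)   ∎

    countDivisible-prefix : ∀ A l → l ≤ L →
      countDivisible L A s l ≡ 0 ⊎ (countDivisible L A s l ≡ 1 × ∃[ i ] (i < l × L ∣ A + s * i))
    countDivisible-prefix A zero    _     = inj₁ refl
    countDivisible-prefix A (suc l) 1+l≤L with countDivisible-prefix A l (<⇒≤ 1+l≤L) | L ∣? A + s * l
    ... | inj₁ c≡0             | yes L∣l = inj₂ (cong (_+ 1) c≡0 , l , n<1+n l , L∣l)
    ... | inj₂ (_ , i , i<l , L∣i) | yes L∣l =
      contradiction (≤-trans (divisible-gap i<l L∣i L∣l) (m∸n≤m l i)) (<⇒≱ 1+l≤L)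
    ... | inj₁ c≡0             | no _ = inj₁ (trans (+-identityʳ _) c≡0)
    ... | inj₂ (c≡1 , i , i<l , L∣i) | no _ =
      inj₂ (trans (+-identityʳ _) c≡1 , i , m<n⇒m<1+n i<l , L∣i)

    countDivisible-period : ∀ A → countDivisible L A s L ≤ 1
    countDivisible-period A with countDivisible-prefix A L ≤-refl
    ... | inj₁ c≡0       = subst (_≤ 1) (sym c≡0) z≤n
    ... | inj₂ (c≡1 , _) = subst (_≤ 1) (sym c≡1) ≤-refl

    countDivisible-periods : ∀ A t → countDivisible L A s (t * L) ≤ t
    countDivisible-periods A zero    = z≤n
    countDivisible-periods A (suc t) = begin
      countDivisible L A s (L + t * L)
        ≡⟨ Σ-+ L (t * L) (λ i → 𝟙 (L ∣? A + s * i)) ⟩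
      countDivisible L A s L + Σ (t * L) (λ i → 𝟙 (L ∣? A + s * (L + i)))
        ≡⟨ cong (countDivisible L A s L +_) (Σ-cong (t * L) (λ i → cong (λ x → 𝟙 (L ∣? x)) (shift i))) ⟩
      countDivisible L A s L + countDivisible L (A + s * L) s (t * L)
        ≤⟨ +-mono-≤ (countDivisible-period A) (countDivisible-periods (A + s * L) t) ⟩
      suc t ∎
      where
      open ≤-Reasoning
      shift : ∀ i → A + s * (L + i) ≡ A + s * L + s * i
      shift i = trans (cong (A +_) (*-distribˡ-+ s L i)) (sym (+-assoc A (s * L) (s * i)))

    countDivisible-≤ : .{{_ : NonZero L}} → ∀ A n → countDivisible L A s n ≤ suc (n / L)
    countDivisible-≤ A n = ≤-trans (Σ-monoˡ-≤ _ n≤) (countDivisible-periods A (suc (n / L)))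
      where
      n≤ : n ≤ suc (n / L) * L
      n≤ = subst (_≤ suc (n / L) * L) (sym (m≡m%n+[m/n]*n n L))
                 (+-monoˡ-≤ (n / L * L) (<⇒≤ (m%n<n n L)))

module OddSquareSieve where

  open FiniteSums
  open DivisibleTerms
  open import Data.Nat
  open import Data.Nat.Properties
  open import Data.Nat.DivMod using (_/_; m/n*n≤m)
  open import Data.Nat.Divisibility using (_∣_; _∣?_; divides)
  open import Data.Nat.Coprimality using (Coprime; sym)
  open import Data.Nat.Primality using (prime[2]; prime⇒irreducible)
  open import Data.Nat.Tactic.RingSolver using (solve-∀)
  open import Data.Product using (∃-syntax; _×_; _,_; map₂)
  open import Data.Sum using (inj₁; inj₂)
  open import Relation.Nullary using (¬_; contradiction)
  open import Relation.Binary.PropositionalEquality hiding (sym)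
  import Relation.Binary.PropositionalEquality as ≡

  ¬2∣odd : ∀ y → ¬ 2 ∣ suc (2 * y)
  ¬2∣odd y (divides q odd≡q*2) = even≢odd q y (≡.sym (trans odd≡q*2 (*-comm q 2)))

  2⊥odd : ∀ y → Coprime 2 (suc (2 * y))
  2⊥odd y (d∣2 , d∣odd) with prime⇒irreducible prime[2] d∣2
  ... | inj₁ d≡1 = d≡1
  ... | inj₂ refl = contradiction d∣odd (¬2∣odd y)

  oddSquare : ℕ → ℕ
  oddSquare j = (3 + 2 * j) * (3 + 2 * j)

  instance
    oddSquare-nonZero : ∀ {j} → NonZero (oddSquare j)
    oddSquare-nonZero = _

  oddSquare⊥2 : ∀ j → Coprime (oddSquare j) 2
  oddSquare⊥2 j = subst (λ x → Coprime x 2) (≡.sym (odd j)) (sym (2⊥odd (2 * (suc j * suc (suc j)))))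
    where
    odd : ∀ j → (3 + 2 * j) * (3 + 2 * j) ≡ suc (2 * (2 * (suc j * suc (suc j))))
    odd = solve-∀

  oddSquare-bound : ∀ n j → n / oddSquare j * (4 * (suc j * suc (suc j))) ≤ n
  oddSquare-bound n j = ≤-trans
    (*-monoʳ-≤ (n / oddSquare j) (subst (4 * (suc j * suc (suc j)) ≤_) (oddSquare≡ j) (n≤1+n _)))
    (m/n*n≤m n (oddSquare j))
    where
    oddSquare≡ : ∀ j → suc (4 * (suc j * suc (suc j))) ≡ (3 + 2 * j) * (3 + 2 * j)
    oddSquare≡ = solve-∀

  -- Σ_{j<J} 1/((j+1)(j+2)) telescopes to J/(J+1).
  Σ-pronic-≤ : ∀ c n (x : ℕ → ℕ) → (∀ j → x j * (c * (suc j * suc (suc j))) ≤ n) →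
               ∀ J → suc J * (c * Σ J x) ≤ J * n
  Σ-pronic-≤ c n x x≤ zero    rewrite *-zeroʳ c = z≤n
  Σ-pronic-≤ c n x x≤ (suc J) = *-cancelˡ-≤ (suc J) (begin
    suc J * (suc (suc J) * (c * (Σ J x + x J)))
      ≡⟨ expand J c (Σ J x) (x J) ⟩
    suc (suc J) * (suc J * (c * Σ J x)) + x J * (c * (suc J * suc (suc J)))
      ≤⟨ +-mono-≤ (*-monoʳ-≤ (suc (suc J)) (Σ-pronic-≤ c n x x≤ J)) (x≤ J) ⟩
    suc (suc J) * (J * n) + n
      ≡⟨ collect J n ⟩
    suc J * (suc J * n) ∎)
    where
    open ≤-Reasoning
    expand : ∀ J c S y → suc J * (suc (suc J) * (c * (S + y)))
                       ≡ suc (suc J) * (suc J * (c * S)) + y * (c * (suc J * suc (suc J)))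
    expand = solve-∀
    collect : ∀ J n → suc (suc J) * (J * n) + n ≡ suc J * (suc J * n)
    collect = solve-∀

  c*Σ-pronic-≤ : ∀ c n (x : ℕ → ℕ) → (∀ j → x j * (c * (suc j * suc (suc j))) ≤ n) →
                 ∀ J → c * Σ J x ≤ n
  c*Σ-pronic-≤ c n x x≤ J =
    *-cancelˡ-≤ (suc J) (≤-trans (Σ-pronic-≤ c n x x≤ J) (*-monoˡ-≤ n (n≤1+n J)))

  oddSquareHit : ℕ → ℕ → ℕ
  oddSquareHit j y = 𝟙 (oddSquare j ∣? suc (2 * y))

  sieveCount : (J a b i : ℕ) → ℕ
  sieveCount J a b i = Σ J (λ j → oddSquareHit j (a + i) + oddSquareHit j (b + i))

  Σ-oddSquareHit-≤ : ∀ j a n → Σ n (λ i → oddSquareHit j (a + i)) ≤ suc (n / oddSquare j)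
  Σ-oddSquareHit-≤ j a n =
    subst (_≤ suc (n / oddSquare j))
          (Σ-cong n (λ i → cong (λ x → 𝟙 (oddSquare j ∣? suc x)) (≡.sym (*-distribˡ-+ 2 a i))))
          (countDivisible-≤ (oddSquare⊥2 j) (suc (2 * a)) n)

  Σ-sieveCount-< : ∀ J n a b → 4 * J < n → Σ n (sieveCount J a b) < n
  Σ-sieveCount-< J n a b 4J<n = *-cancelˡ-< 2 (Σ n (sieveCount J a b)) n (begin-strict
    2 * Σ n (sieveCount J a b)
      ≡⟨ cong (2 *_) (Σ-comm n J (λ i j → oddSquareHit j (a + i) + oddSquareHit j (b + i))) ⟩
    2 * Σ J (λ j → Σ n (λ i → oddSquareHit j (a + i) + oddSquareHit j (b + i)))
      ≤⟨ *-monoʳ-≤ 2 (Σ-mono-≤ J per-modulus) ⟩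
    2 * Σ J (λ j → suc (x j) + suc (x j))
      ≡⟨ cong (2 *_) (trans (Σ-distrib-+ J (λ j → suc (x j)) (λ j → suc (x j))) (cong₂ _+_ Σsuc Σsuc)) ⟩
    2 * ((J + Σ J x) + (J + Σ J x))
      ≡⟨ regroup J (Σ J x) ⟩
    4 * J + 4 * Σ J x
      ≤⟨ +-monoʳ-≤ (4 * J) (c*Σ-pronic-≤ 4 n x (oddSquare-bound n) J) ⟩
    4 * J + n
      <⟨ +-monoˡ-< n 4J<n ⟩
    n + n
      ≡⟨ cong (n +_) (+-identityʳ n) ⟨
    2 * n ∎)
    where
    open ≤-Reasoning
    x : ℕ → ℕ
    x j = n / oddSquare j
    per-modulus : ∀ j → j < J →
                  Σ n (λ i → oddSquareHit j (a + i) + oddSquareHit j (b + i)) ≤ suc (x j) + suc (x j)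
    per-modulus j _ = begin
      Σ n (λ i → oddSquareHit j (a + i) + oddSquareHit j (b + i))
        ≡⟨ Σ-distrib-+ n (λ i → oddSquareHit j (a + i)) (λ i → oddSquareHit j (b + i)) ⟩
      Σ n (λ i → oddSquareHit j (a + i)) + Σ n (λ i → oddSquareHit j (b + i))
        ≤⟨ +-mono-≤ (Σ-oddSquareHit-≤ j a n) (Σ-oddSquareHit-≤ j b n) ⟩
      suc (x j) + suc (x j) ∎
    Σsuc : Σ J (λ j → suc (x j)) ≡ J + Σ J x
    Σsuc = trans (Σ-distrib-+ J (λ _ → 1) x) (cong (_+ Σ J x) (trans (Σ-const J 1) (*-identityʳ J)))
    regroup : ∀ J S → 2 * ((J + S) + (J + S)) ≡ 4 * J + 4 * S
    regroup = solve-∀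

  sieveCount≡0⇒sieved : ∀ {J a b i} → sieveCount J a b i ≡ 0 →
    ∀ j → j < J → ¬ oddSquare j ∣ suc (2 * (a + i)) × ¬ oddSquare j ∣ suc (2 * (b + i))
  sieveCount≡0⇒sieved {J} {a} {b} {i} count≡0 j j<J =
    𝟙≡0⇒¬ (oddSquare j ∣? suc (2 * (a + i))) (m+n≡0⇒m≡0 (oddSquareHit j (a + i)) both≡0) ,
    𝟙≡0⇒¬ (oddSquare j ∣? suc (2 * (b + i))) (m+n≡0⇒n≡0 (oddSquareHit j (a + i)) both≡0)
    where
    both≡0 : oddSquareHit j (a + i) + oddSquareHit j (b + i) ≡ 0
    both≡0 = Σ≡0⇒≡0 J (λ j → oddSquareHit j (a + i) + oddSquareHit j (b + i)) count≡0 j j<J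

  sieve : ∀ J n a b → 4 * J < n → ∃[ i ] (i < n ×
            ∀ j → j < J → ¬ oddSquare j ∣ suc (2 * (a + i)) × ¬ oddSquare j ∣ suc (2 * (b + i)))
  sieve J n a b 4J<n = map₂ (map₂ (sieveCount≡0⇒sieved {J} {a} {b}))
                            (Σ<n⇒∃≡0 n (sieveCount J a b) (Σ-sieveCount-< J n a b 4J<n))

module SquareFreeOddPairs where

  open import Defs using (SquareFree)
  open OddSquareSieve
  open import Data.Nat
  open import Data.Nat.Properties
  open import Data.Nat.Divisibility
  open import Data.Nat.Coprimality using (Coprime; coprime-divisor; coprime-+; sym)
  open import Data.Nat.Primality using (Prime; euclidsLemma; prime⇒nonZero; ¬prime[1])
  open import Data.Nat.Primality.Factorisation using (factorise)
  open import Data.Nat.Tactic.RingSolver using (solve)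
  open Offset
  open import Algebra.Properties.CommutativeSemigroup +-commutativeSemigroup using (xy∙z≈xz∙y)
  open import Data.Integer using (+_)
  open import Data.List using ([]; _∷_)
  import Data.List.Relation.Unary.All as All
  open import Data.Product using (∃-syntax; _×_; _,_; proj₁; proj₂)
  open import Data.Sum using (_⊎_; inj₁; inj₂)
  open import Relation.Nullary using (¬_; yes; no; contradiction)
  open import Relation.Binary.PropositionalEquality using (_≡_; _≢_; refl; cong; subst)
  import Relation.Binary.PropositionalEquality as ≡

  prime-divisor : ∀ n → ∃[ q ] (Prime q × q ∣ 2 + n)
  prime-divisor n with factorise (2 + n)
  ... | record { factors = q ∷ _ ; isFactorisation = eq ; factorsPrime = q-prime All.∷ _ } =
    q , q-prime , subst (q ∣_) (≡.sym eq) (m∣m*n _)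

  even⊎odd : ∀ n → ∃[ j ] (n ≡ 2 * j) ⊎ ∃[ j ] (n ≡ suc (2 * j))
  even⊎odd zero    = inj₁ (0 , refl)
  even⊎odd (suc n) with even⊎odd n
  ... | inj₁ (j , refl) = inj₂ (j , refl)
  ... | inj₂ (j , refl) = inj₁ (suc j , cong suc (≡.sym (+-suc j (j + 0))))

  coprime-*ˡ : ∀ {m n o} → Coprime m o → Coprime n o → Coprime (m * n) o
  coprime-*ˡ {m} m⊥o n⊥o {d} (d∣mn , d∣o) = n⊥o (coprime-divisor d⊥m d∣mn , d∣o)
    where
    d⊥m : Coprime d m
    d⊥m (e∣d , e∣m) = m⊥o (e∣m , ∣-trans e∣d d∣o)

  odd⊥odd+2c : ∀ {c} y → Coprime c (suc (2 * y)) → Coprime (suc (2 * y)) (suc (2 * (y + c)))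
  odd⊥odd+2c {c} y c⊥odd = subst (Coprime (suc (2 * y))) (cong suc (≡.sym (*-distribˡ-+ 2 y c)))
    (sym (coprime-+ (coprime-*ˡ (2⊥odd y) c⊥odd)))

  squarefree⇒≢0 : ∀ {a} → SquareFree (+ a) → a ≢ 0
  squarefree⇒≢0 sf refl with sf 2 (4 ∣0)
  ... | ()

  prime∣*∧∤⇒∣ : ∀ {q a b} → Prime q → q ∣ a * b → ¬ q ∣ b → q ∣ a
  prime∣*∧∤⇒∣ {a = a} {b} q-prime q∣ab q∤b with euclidsLemma a b q-prime q∣ab
  ... | inj₁ q∣a = q∣a
  ... | inj₂ q∣b = contradiction q∣b q∤b

  prime²∣*⇒prime²∣ : ∀ {q a b} → Prime q → q * q ∣ a * b → ¬ q ∣ b → q * q ∣ a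
  prime²∣*⇒prime²∣ {q} {a} {b} q-prime q²∣ab q∤b
    with prime∣*∧∤⇒∣ {a = a} q-prime (∣-trans (m∣m*n q) q²∣ab) q∤b
  ... | divides a′ refl = *-pres-∣ (prime∣*∧∤⇒∣ {a = a′} q-prime q∣a′b q∤b) (∣-refl {q})
    where
    regroup : ∀ a′ q b → a′ * q * b ≡ q * (a′ * b)
    regroup a′ q b = solve (a′ ∷ q ∷ b ∷ [])
    q∣a′b : q ∣ a′ * b
    q∣a′b = *-cancelˡ-∣ q {{prime⇒nonZero q-prime}} (subst (q * q ∣_) (regroup a′ q b) q²∣ab)

  squarefree-* : ∀ {a b} → Coprime a b → SquareFree (+ a) → SquareFree (+ b) → SquareFree (+ (a * b))
  squarefree-* {a} {b} a⊥b sfa sfb zero 0∣ab with m*n≡0⇒m≡0∨n≡0 a (0∣⇒≡0 0∣ab)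
  ... | inj₁ a≡0 = contradiction a≡0 (squarefree⇒≢0 sfa)
  ... | inj₂ b≡0 = contradiction b≡0 (squarefree⇒≢0 sfb)
  squarefree-* a⊥b sfa sfb 1 _ = refl
  squarefree-* {a} {b} a⊥b sfa sfb (suc (suc n)) p²∣ab with prime-divisor n
  ... | q , q-prime , q∣p = contradiction q≡1 q≢1
    where
    q≢1 : q ≢ 1
    q≢1 refl = ¬prime[1] q-prime
    q²∣ab : q * q ∣ a * b
    q²∣ab = ∣-trans (*-pres-∣ q∣p q∣p) p²∣ab
    q≡1 : q ≡ 1
    q≡1 with euclidsLemma a b q-prime (∣-trans (m∣m*n q) q²∣ab)
    ... | inj₁ q∣a = sfa q (prime²∣*⇒prime²∣ q-prime q²∣ab (λ q∣b → q≢1 (a⊥b (q∣a , q∣b))))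
    ... | inj₂ q∣b = sfb q (prime²∣*⇒prime²∣ q-prime (subst (q * q ∣_) (*-comm a b) q²∣ab)
                                              (λ q∣a → q≢1 (a⊥b (q∣a , q∣b))))

  oddSquare-mono-≤ : ∀ {i j} → i ≤ j → oddSquare i ≤ oddSquare j
  oddSquare-mono-≤ i≤j = *-mono-≤ 3+2i≤3+2j 3+2i≤3+2j
    where 3+2i≤3+2j = +-monoʳ-≤ 3 (*-monoʳ-≤ 2 i≤j)

  squarefree-sieved : ∀ {J y} → suc (2 * y) < oddSquare J →
                      (∀ j → j < J → ¬ oddSquare j ∣ suc (2 * y)) → SquareFree (+ suc (2 * y))
  squarefree-sieved _ _ zero 0∣x = contradiction (0∣⇒≡0 0∣x) λ ()
  squarefree-sieved _ _ 1    _   = refl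
  squarefree-sieved {J} {y} x<J² sieved (suc (suc r)) p²∣x with even⊎odd r
  ... | inj₁ (j , refl) = contradiction (∣-trans 2∣p (∣-trans (m∣m*n (2 + 2 * j)) p²∣x)) (¬2∣odd y)
    where
    2∣p : 2 ∣ 2 + 2 * j
    2∣p = divides (suc j) (solve (j ∷ []))
  ... | inj₂ (j , refl) with j <? J
  ...   | yes j<J = contradiction p²∣x (sieved j j<J)
  ...   | no  j≮J = contradiction (≤-trans (oddSquare-mono-≤ (≮⇒≥ j≮J)) (∣⇒≤ p²∣x)) (<⇒≱ x<J²)

  oddPair : ℕ → ℕ → ℕ
  oddPair c q = suc (2 * q) * suc (2 * (q + c))

  q<oddPair : ∀ c q → q < oddPair c q
  q<oddPair c q = <-≤-trans (s≤s (m≤m+n q (q + 0))) (m≤m*n (suc (2 * q)) (suc (2 * (q + c))))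

  -- Sieve q = J² + i, i < J², by the odd squares (2j+3)², j < J: both members of the pair lie below (2J+3)².
  squarefree-odd-pairs : ∀ c → (∀ y → Coprime c (suc (2 * y))) →
                         ∀ N → ∃[ q ] (N < q × SquareFree (+ oddPair c q))
  squarefree-odd-pairs c c⊥odd N = pick (sieve J n n (n + c) (4J<J² k))
    where
    k = c + N
    J = 5 + k
    n = J * J
    4J<J² : ∀ k → 4 * (5 + k) < (5 + k) * (5 + k)
    4J<J² k = ≤-offset (k * k + 6 * k + 4) (solve (k ∷ []))
    2J²<J² : ∀ k → suc (2 * ((5 + k) * (5 + k) + (5 + k) * (5 + k) + k))
                   < (3 + 2 * (5 + k)) * (3 + 2 * (5 + k))
    2J²<J² k = ≤-offset (67 + 10 * k) (solve (k ∷ []))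
    pick : ∃[ i ] (i < n ×
             ∀ j → j < J → ¬ oddSquare j ∣ suc (2 * (n + i)) × ¬ oddSquare j ∣ suc (2 * (n + c + i))) →
           ∃[ q ] (N < q × SquareFree (+ oddPair c q))
    pick (i , i<n , sieved) = n + i , N<n+i , squarefree-* (odd⊥odd+2c (n + i) (c⊥odd (n + i))) sf₁ sf₂
      where
      x₂<J² : suc (2 * (n + i + c)) < oddSquare J
      x₂<J² = ≤-<-trans (s≤s (*-monoʳ-≤ 2 (+-mono-≤ (+-monoʳ-≤ n (<⇒≤ i<n)) (m≤m+n c N))))
                        (2J²<J² k)
      sf₁ : SquareFree (+ suc (2 * (n + i)))
      sf₁ = squarefree-sieved {J} {n + i} (≤-<-trans (s≤s (*-monoʳ-≤ 2 (m≤m+n (n + i) c))) x₂<J²)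
                                          (λ j j<J → proj₁ (sieved j j<J))
      sf₂ : SquareFree (+ suc (2 * (n + i + c)))
      sf₂ = squarefree-sieved {J} {n + i + c} x₂<J²
              (λ j j<J → subst (λ x → ¬ oddSquare j ∣ suc (2 * x)) (xy∙z≈xz∙y n c i)
                               (proj₂ (sieved j j<J)))
      N<n+i : N < n + i
      N<n+i = ≤-trans (s≤s (m≤n+m N (4 + c))) (≤-trans (m≤m*n J J) (m≤m+n n i))

module IntegralPoints where

  open import Defs
  open import Data.Nat as ℕ using (ℕ; suc; zero)
  open import Data.Integer as ℤ using (ℤ; +_; -[1+_]; ∣_∣)
  import Data.Integer.Properties as ℤ
  open import Data.Rational using (mkℚ; 0ℚ; _+_; _*_; -_; _≤_; *≤*; ↥_)
  open import Data.Rational.Properties using (normalize-coprime)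
  open import Data.Nat.Coprimality using (1-coprimeTo; sym)
  open import Data.Product using (_,_; ∃-syntax)
  open import Data.Integer.Tactic.RingSolver using (solve-∀)
  open import Relation.Binary.PropositionalEquality hiding (sym)
  import Relation.Binary.PropositionalEquality as ≡

  ι-mkℚ : ∀ a → ι a ≡ mkℚ a 0 (sym (1-coprimeTo ∣ a ∣))
  ι-mkℚ (+ n)    = normalize-coprime (sym (1-coprimeTo n))
  ι-mkℚ -[1+ n ] = cong -_ (normalize-coprime (sym (1-coprimeTo (suc n))))

  ι-homo-+ : ∀ a b → ι a + ι b ≡ ι (a ℤ.+ b)
  ι-homo-+ a b =
    trans (cong₂ _+_ (ι-mkℚ a) (ι-mkℚ b)) (cong ι (cong₂ ℤ._+_ (ℤ.*-identityʳ a) (ℤ.*-identityʳ b)))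

  ι-homo-* : ∀ a b → ι a * ι b ≡ ι (a ℤ.* b)
  ι-homo-* a b = cong₂ _*_ (ι-mkℚ a) (ι-mkℚ b)

  ι-homo‿- : ∀ a → - ι a ≡ ι (ℤ.- a)
  ι-homo‿- a = trans (cong -_ (ι-mkℚ a)) (trans (-mkℚ a) (≡.sym (ι-mkℚ (ℤ.- a))))
    where
    -mkℚ : ∀ a → - mkℚ a 0 (sym (1-coprimeTo ∣ a ∣)) ≡ mkℚ (ℤ.- a) 0 (sym (1-coprimeTo ∣ ℤ.- a ∣))
    -mkℚ (+ zero)  = refl
    -mkℚ (+ suc n) = refl
    -mkℚ -[1+ n ]  = refl

  ι-mono-≤ : ∀ {a b} → a ℤ.≤ b → ι a ≤ ι b
  ι-mono-≤ {a} {b} a≤b = subst₂ _≤_ (≡.sym (ι-mkℚ a)) (≡.sym (ι-mkℚ b))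
    (*≤* (subst₂ ℤ._≤_ (≡.sym (ℤ.*-identityʳ a)) (≡.sym (ℤ.*-identityʳ b)) a≤b))

  ι-injective : ∀ {a b} → ι a ≡ ι b → a ≡ b
  ι-injective {a} {b} ιa≡ιb =
    trans (cong ↥_ (≡.sym (ι-mkℚ a))) (trans (cong ↥_ ιa≡ιb) (cong ↥_ (ι-mkℚ b)))

  ⟨_,_⟩ : ℤ → ℤ → K
  ⟨ a , b ⟩ = ι a , ι b

  ⟨⟩-+K : ∀ a b c d → ⟨ a , b ⟩ +K ⟨ c , d ⟩ ≡ ⟨ a ℤ.+ c , b ℤ.+ d ⟩
  ⟨⟩-+K a b c d = cong₂ _,_ (ι-homo-+ a c) (ι-homo-+ b d)

  ⟨⟩--K : ∀ a b → -K ⟨ a , b ⟩ ≡ ⟨ ℤ.- a , ℤ.- b ⟩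
  ⟨⟩--K a b = cong₂ _,_ (ι-homo‿- a) (ι-homo‿- b)

  ⟨⟩-mulK : ∀ D a b c d →
            mulK D ⟨ a , b ⟩ ⟨ c , d ⟩ ≡ ⟨ a ℤ.* c ℤ.+ D ℤ.* (b ℤ.* d) , a ℤ.* d ℤ.+ b ℤ.* c ⟩
  ⟨⟩-mulK D a b c d = cong₂ _,_
    (trans (cong₂ _+_ (ι-homo-* a c) (trans (cong (ι D *_) (ι-homo-* b d)) (ι-homo-* D (b ℤ.* d))))
           (ι-homo-+ (a ℤ.* c) (D ℤ.* (b ℤ.* d))))
    (trans (cong₂ _+_ (ι-homo-* a d) (ι-homo-* b c)) (ι-homo-+ (a ℤ.* d) (b ℤ.* c)))

  ⟨⟩≢0K : ∀ a → ⟨ a , + 1 ⟩ ≢ 0K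
  ⟨⟩≢0K a ()

  ι-form : ∀ D x y → ι x * ι x + ι D * (ι y * ι y) ≡ ι (x ℤ.* x ℤ.+ D ℤ.* (y ℤ.* y))
  ι-form D x y =
    trans (cong₂ _+_ (ι-homo-* x x) (trans (cong (ι D *_) (ι-homo-* y y)) (ι-homo-* D (y ℤ.* y))))
          (ι-homo-+ (x ℤ.* x) (D ℤ.* (y ℤ.* y)))

  -- The factor 2 in the real case comes from the two real embeddings a ± b√D.
  minkowskiWeight : ℤ → ℕ
  minkowskiWeight (+ _)    = 2
  minkowskiWeight -[1+ _ ] = 1

  sqNorm-⟨⟩ : ∀ D x y →
              sqNorm D ⟨ x , y ⟩ ≡ ι (+ minkowskiWeight D ℤ.* (x ℤ.* x ℤ.+ + ∣ D ∣ ℤ.* (y ℤ.* y)))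
  sqNorm-⟨⟩ (+ n)    x y =
    trans (cong (ι (+ 2) *_) (ι-form (+ n) x y)) (ι-homo-* (+ 2) (x ℤ.* x ℤ.+ + n ℤ.* (y ℤ.* y)))
  sqNorm-⟨⟩ -[1+ k ] x y =
    trans (ι-form (+ suc k) x y) (cong ι (≡.sym (ℤ.*-identityˡ (x ℤ.* x ℤ.+ + suc k ℤ.* (y ℤ.* y)))))

  LinIndep-⟨⟩ : ∀ a b c d → a ℤ.* d ℤ.- b ℤ.* c ≢ + 0 → LinIndep ⟨ a , b ⟩ ⟨ c , d ⟩
  LinIndep-⟨⟩ a b c d det≢0 det≡0 = det≢0 (ι-injective (trans (≡.sym det≡) det≡0))
    where
    det≡ : ι a * ι d + - (ι b * ι c) ≡ ι (a ℤ.* d ℤ.- b ℤ.* c)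
    det≡ = trans (cong₂ _+_ (ι-homo-* a d) (trans (cong -_ (ι-homo-* b c)) (ι-homo‿- (b ℤ.* c))))
                 (ι-homo-+ (a ℤ.* d) (ℤ.- (b ℤ.* c)))

  module _ {D : ℤ} (ω≡√D : ω D ≡ ⟨ + 0 , + 1 ⟩) where

    OK-element≡⟨⟩ : ∀ m n → (ι m , 0ℚ) +K mulK D (ι n , 0ℚ) (ω D) ≡ ⟨ m , n ⟩
    OK-element≡⟨⟩ m n = begin
      ⟨ m , + 0 ⟩ +K mulK D ⟨ n , + 0 ⟩ (ω D)
        ≡⟨ cong (λ o → ⟨ m , + 0 ⟩ +K mulK D ⟨ n , + 0 ⟩ o) ω≡√D ⟩
      ⟨ m , + 0 ⟩ +K mulK D ⟨ n , + 0 ⟩ ⟨ + 0 , + 1 ⟩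
        ≡⟨ cong (⟨ m , + 0 ⟩ +K_) (⟨⟩-mulK D n (+ 0) (+ 0) (+ 1)) ⟩
      ⟨ m , + 0 ⟩ +K ⟨ n ℤ.* + 0 ℤ.+ D ℤ.* (+ 0 ℤ.* + 1) , n ℤ.* + 1 ℤ.+ + 0 ℤ.* + 0 ⟩
        ≡⟨ ⟨⟩-+K m (+ 0) (n ℤ.* + 0 ℤ.+ D ℤ.* (+ 0 ℤ.* + 1)) (n ℤ.* + 1 ℤ.+ + 0 ℤ.* + 0) ⟩
      ⟨ m ℤ.+ (n ℤ.* + 0 ℤ.+ D ℤ.* (+ 0 ℤ.* + 1)) , + 0 ℤ.+ (n ℤ.* + 1 ℤ.+ + 0 ℤ.* + 0) ⟩
        ≡⟨ cong₂ ⟨_,_⟩ (re₁ m n D) (re₂ n) ⟩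
      ⟨ m , n ⟩ ∎
      where
      open ≡-Reasoning
      re₁ : ∀ m n D → m ℤ.+ (n ℤ.* + 0 ℤ.+ D ℤ.* (+ 0 ℤ.* + 1)) ≡ m
      re₁ = solve-∀
      re₂ : ∀ n → + 0 ℤ.+ (n ℤ.* + 1 ℤ.+ + 0 ℤ.* + 0) ≡ n
      re₂ = solve-∀

    InOK⇒⟨⟩ : ∀ {x} → InOK D x → ∃[ a ] ∃[ b ] x ≡ ⟨ a , b ⟩
    InOK⇒⟨⟩ (m , n , x≡) = m , n , trans x≡ (OK-element≡⟨⟩ m n)

    ⟨⟩∈OK : ∀ a b → InOK D ⟨ a , b ⟩
    ⟨⟩∈OK a b = a , b , ≡.sym (OK-element≡⟨⟩ a b)

module BinaryForm where

  open import Data.Nat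
  open import Data.Nat.Properties
  open import Data.Nat.Tactic.RingSolver using (solve)
  open import Data.List using ([]; _∷_)
  open import Relation.Binary.PropositionalEquality

  form : ℕ → ℕ → ℕ → ℕ → ℕ
  form m P a b = m * m * (a * a) + P * (b * b)

  -- The two implications are what is used of "a ≡ b (mod 2) and (a, b) ≠ (0, 0)".
  form-min : ∀ {m P} a b → m * m ≤ P → P ≤ 3 * (m * m) → (a ≡ 0 → 2 ≤ b) → (b ≡ 0 → 2 ≤ a) →
             form m P 1 1 ≤ form m P a b
  form-min {m} {P} a b m²≤P P≤3m² a≡0⇒2≤b b≡0⇒2≤a = begin
    form m P 1 1          ≡⟨ cong₂ _+_ (*-identityʳ (m * m)) (*-identityʳ P) ⟩
    m * m + P             ≤⟨ bound a b a≡0⇒2≤b b≡0⇒2≤a ⟩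
    form m P a b          ∎
    where
    open ≤-Reasoning
    4≤sq : ∀ {k} → 2 ≤ k → 4 ≤ k * k
    4≤sq 2≤k = *-mono-≤ 2≤k 2≤k
    bound : ∀ a b → (a ≡ 0 → 2 ≤ b) → (b ≡ 0 → 2 ≤ a) → m * m + P ≤ form m P a b
    bound zero b a≡0⇒2≤b _ = begin
      m * m + P             ≤⟨ +-monoˡ-≤ P m²≤P ⟩
      P + P                 ≤⟨ m≤m+n (P + P) (P + P) ⟩
      P + P + (P + P)       ≡⟨ solve (P ∷ []) ⟩
      P * 4                 ≤⟨ *-monoʳ-≤ P (4≤sq (a≡0⇒2≤b refl)) ⟩
      P * (b * b)           ≤⟨ m≤n+m (P * (b * b)) (m * m * 0) ⟩
      form m P 0 b          ∎
    bound (suc a) zero _ b≡0⇒2≤a = begin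
      m * m + P             ≤⟨ +-monoʳ-≤ (m * m) P≤3m² ⟩
      m * m + 3 * (m * m)   ≡⟨ solve (m ∷ []) ⟩
      m * m * 4             ≤⟨ *-monoʳ-≤ (m * m) (4≤sq (b≡0⇒2≤a refl)) ⟩
      m * m * (suc a * suc a) ≤⟨ m≤m+n (m * m * (suc a * suc a)) (P * 0) ⟩
      form m P (suc a) zero ∎
    bound (suc a) (suc b) _ _ = +-mono-≤ (m≤m*n (m * m) (suc a * suc a)) (m≤m*n P (suc b * suc b))

module WellRoundedIdeal where

  open import Defs
  open IntegralPoints
  open BinaryForm
  open import Data.Nat as ℕ using (ℕ; suc; zero; NonZero; z≤n; s≤s)
  import Data.Nat.Properties as ℕ
  open import Data.Integer using (ℤ; +_; -[1+_]; ∣_∣; +≤+; _+_; _*_; _-_; -_)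
  import Data.Integer.Properties as ℤ
  open import Data.Integer.Tactic.RingSolver using (solve-∀)
  open import Data.Rational using (_≤_)
  open import Data.Product using (∃-syntax; _×_; _,_)
  open import Data.Sum using (_⊎_; inj₁; inj₂)
  open import Relation.Nullary using (contradiction)
  open import Relation.Binary.PropositionalEquality

  -- The ideal (2m, m + √D) of ℤ[√D]: t (m + √D) + w (2m) = m (t + 2w) + t √D.
  𝔞 : ℤ → K → Set
  𝔞 M x = ∃[ w ] ∃[ t ] x ≡ ⟨ M * (t + + 2 * w) , t ⟩

  𝔞-isIdeal : ∀ {D M h} → D ≡ M * (M + + 2 * h) → ω D ≡ ⟨ + 0 , + 1 ⟩ → IsIdeal D (𝔞 M)
  𝔞-isIdeal {D} {M} {h} D≡ ω≡√D = record
    { ⊆OK        = λ { _ (w , t , refl) → ⟨⟩∈OK {D} ω≡√D (M * (t + + 2 * w)) t }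
    ; 0∈         = + 0 , + 0 , cong (λ a → ⟨ a , + 0 ⟩) (sym (ℤ.*-zeroʳ M))
    ; +-closed   = λ { _ _ (w , t , refl) (w′ , t′ , refl) → w + w′ , t + t′ ,
                       trans (⟨⟩-+K (M * (t + + 2 * w)) t (M * (t′ + + 2 * w′)) t′)
                             (cong (λ a → ⟨ a , t + t′ ⟩) (+-lemma M t w t′ w′)) }
    ; neg-closed = λ { _ (w , t , refl) → - w , - t ,
                       trans (⟨⟩--K (M * (t + + 2 * w)) t) (cong (λ a → ⟨ a , - t ⟩) (neg-lemma M t w)) }
    ; mul-closed = λ { _ _ r∈OK (w , t , refl) → mul-closed (InOK⇒⟨⟩ {D} ω≡√D r∈OK) w t }
    }
    where
    +-lemma : ∀ M t w t′ w′ → M * (t + + 2 * w) + M * (t′ + + 2 * w′)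
                            ≡ M * ((t + t′) + + 2 * (w + w′))
    +-lemma = solve-∀
    neg-lemma : ∀ M t w → - (M * (t + + 2 * w)) ≡ M * (- t + + 2 * - w)
    neg-lemma = solve-∀
    mul-lemma : ∀ M h a b t w →
      a * (M * (t + + 2 * w)) + M * (M + + 2 * h) * (b * t)
        ≡ M * ((a * t + b * (M * (t + + 2 * w)))
                 + + 2 * (a * w + b * t * h - b * M * w))
    mul-lemma = solve-∀
    mul-closed : ∀ {r} → ∃[ a ] ∃[ b ] r ≡ ⟨ a , b ⟩ →
                 ∀ w t → 𝔞 M (mulK D r ⟨ M * (t + + 2 * w) , t ⟩)
    mul-closed (a , b , refl) w t =
      a * w + b * t * h - b * M * w , a * t + b * u′ ,
      trans (⟨⟩-mulK D a b u′ t)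
            (cong (λ c → ⟨ c , a * t + b * u′ ⟩)
                  (trans (cong (λ D → a * u′ + D * (b * t)) D≡) (mul-lemma M h a b t w)))
      where u′ = M * (t + + 2 * w)

  i*i≡∣i∣*∣i∣ : ∀ i → i * i ≡ + (∣ i ∣ ℕ.* ∣ i ∣)
  i*i≡∣i∣*∣i∣ (+ n)    = sym (ℤ.pos-* n n)
  i*i≡∣i∣*∣i∣ -[1+ n ] = refl

  weighted-form : ∀ c m P u t →
    + c * ((+ m * u) * (+ m * u) + + P * (t * t)) ≡ + (c ℕ.* form m P (∣ u ∣) (∣ t ∣))
  weighted-form c m P u t = begin
    + c * ((+ m * u) * (+ m * u) + + P * (t * t))
      ≡⟨ regroup (+ c) (+ m) (+ P) u t ⟩
    + c * (+ m * + m * (u * u) + + P * (t * t))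
      ≡⟨ cong₂ (λ x y → + c * (+ m * + m * x + + P * y)) (i*i≡∣i∣*∣i∣ u) (i*i≡∣i∣*∣i∣ t) ⟩
    + c * (+ m * + m * + A + + P * + B)
      ≡⟨ cong (λ x → + c * (x * + A + + P * + B)) (ℤ.pos-* m m) ⟨
    + c * (+ (m ℕ.* m) * + A + + P * + B)
      ≡⟨ cong₂ (λ x y → + c * (x + y)) (ℤ.pos-* (m ℕ.* m) A) (ℤ.pos-* P B) ⟨
    + c * (+ (m ℕ.* m ℕ.* A) + + (P ℕ.* B))
      ≡⟨ cong (+ c *_) (ℤ.pos-+ (m ℕ.* m ℕ.* A) (P ℕ.* B)) ⟨
    + c * + form m P (∣ u ∣) (∣ t ∣)
      ≡⟨ ℤ.pos-* c (form m P (∣ u ∣) (∣ t ∣)) ⟨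
    + (c ℕ.* form m P (∣ u ∣) (∣ t ∣)) ∎
    where
    open ≡-Reasoning
    A = ∣ u ∣ ℕ.* ∣ u ∣
    B = ∣ t ∣ ℕ.* ∣ t ∣
    regroup : ∀ c m P u t → c * ((m * u) * (m * u) + P * (t * t))
                          ≡ c * (m * m * (u * u) + P * (t * t))
    regroup = solve-∀

  sqNorm-⟨m*u,t⟩ : ∀ D m u t →
    sqNorm D ⟨ + m * u , t ⟩ ≡ ι (+ (minkowskiWeight D ℕ.* form m (∣ D ∣) (∣ u ∣) (∣ t ∣)))
  sqNorm-⟨m*u,t⟩ D m u t =
    trans (sqNorm-⟨⟩ D (+ m * u) t) (cong ι (weighted-form (minkowskiWeight D) m ∣ D ∣ u t))

  ∣2w∣≡0⊎2≤∣2w∣ : ∀ w → ∣ + 2 * w ∣ ≡ 0 ⊎ 2 ℕ.≤ ∣ + 2 * w ∣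
  ∣2w∣≡0⊎2≤∣2w∣ w rewrite ℤ.abs-* (+ 2) w with ∣ w ∣
  ... | zero  = inj₁ refl
  ... | suc _ = inj₂ (ℕ.*-monoʳ-≤ 2 (s≤s z≤n))

  -- u = t + 2w and t have equal parity.
  𝔞-parity : ∀ M t w → ⟨ M * (t + + 2 * w) , t ⟩ ≢ 0K →
             (∣ t + + 2 * w ∣ ≡ 0 → 2 ℕ.≤ ∣ t ∣) × (∣ t ∣ ≡ 0 → 2 ℕ.≤ ∣ t + + 2 * w ∣)
  𝔞-parity M t w x≢0 = gapₜ , gapᵤ
    where
    u = t + + 2 * w
    not-both-0 : ∣ u ∣ ≡ 0 → ∣ t ∣ ≢ 0
    not-both-0 ∣u∣≡0 ∣t∣≡0 = x≢0 (begin
      ⟨ M * u , t ⟩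
        ≡⟨ cong₂ (λ u t → ⟨ M * u , t ⟩) (ℤ.∣i∣≡0⇒i≡0 {u} ∣u∣≡0) (ℤ.∣i∣≡0⇒i≡0 {t} ∣t∣≡0) ⟩
      ⟨ M * + 0 , + 0 ⟩
        ≡⟨ cong (λ a → ⟨ a , + 0 ⟩) (ℤ.*-zeroʳ M) ⟩
      0K ∎)
      where open ≡-Reasoning
    either-≥2 : ∀ {x} → x ≢ 0 → x ≡ ∣ + 2 * w ∣ → 2 ℕ.≤ x
    either-≥2 x≢0 refl with ∣2w∣≡0⊎2≤∣2w∣ w
    ... | inj₁ x≡0 = contradiction x≡0 x≢0
    ... | inj₂ 2≤x = 2≤x
    t≡u-2w : t ≡ u - + 2 * w
    t≡u-2w = cancel t w
      where
      cancel : ∀ t w → t ≡ t + + 2 * w - + 2 * w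
      cancel = solve-∀
    gapₜ : ∣ u ∣ ≡ 0 → 2 ℕ.≤ ∣ t ∣
    gapₜ ∣u∣≡0 = either-≥2 (not-both-0 ∣u∣≡0) (begin
      ∣ t ∣                       ≡⟨ cong ∣_∣ t≡u-2w ⟩
      ∣ u - + 2 * w ∣         ≡⟨ cong (λ u → ∣ u - + 2 * w ∣) (ℤ.∣i∣≡0⇒i≡0 {u} ∣u∣≡0) ⟩
      ∣ + 0 - + 2 * w ∣       ≡⟨ cong ∣_∣ (ℤ.+-identityˡ (- (+ 2 * w))) ⟩
      ∣ - (+ 2 * w) ∣         ≡⟨ ℤ.∣-i∣≡∣i∣ (+ 2 * w) ⟩
      ∣ + 2 * w ∣               ∎)
      where open ≡-Reasoning
    gapᵤ : ∣ t ∣ ≡ 0 → 2 ℕ.≤ ∣ u ∣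
    gapᵤ ∣t∣≡0 = either-≥2 (λ ∣u∣≡0 → not-both-0 ∣u∣≡0 ∣t∣≡0)
      (cong ∣_∣ (trans (cong (_+ + 2 * w) (ℤ.∣i∣≡0⇒i≡0 {t} ∣t∣≡0)) (ℤ.+-identityˡ (+ 2 * w))))

  module _ {D : ℤ} (m : ℕ) .{{_ : NonZero m}} (h : ℤ) (D≡ : D ≡ + m * (+ m + + 2 * h))
           (ω≡√D : ω D ≡ ⟨ + 0 , + 1 ⟩)
           (m²≤∣D∣ : m ℕ.* m ℕ.≤ ∣ D ∣) (∣D∣≤3m² : ∣ D ∣ ℕ.≤ 3 ℕ.* (m ℕ.* m)) where

    𝔞-minimal : ∀ w → ∣ + 1 + + 2 * w ∣ ≡ 1 → IsMinimal D (𝔞 (+ m)) ⟨ + m * (+ 1 + + 2 * w) , + 1 ⟩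
    𝔞-minimal w ∣u∣≡1 =
      (w , + 1 , refl) , ⟨⟩≢0K (+ m * (+ 1 + + 2 * w)) , λ { _ (w′ , t , refl) x≢0 → ≤-norm w′ t x≢0 }
      where
      ≤-norm : ∀ w′ t → ⟨ + m * (t + + 2 * w′) , t ⟩ ≢ 0K →
               sqNorm D ⟨ + m * (+ 1 + + 2 * w) , + 1 ⟩ ≤ sqNorm D ⟨ + m * (t + + 2 * w′) , t ⟩
      ≤-norm w′ t x≢0 with 𝔞-parity (+ m) t w′ x≢0
      ... | gapₜ , gapᵤ =
        subst₂ _≤_ (sym (sqNorm-⟨m*u,t⟩ D m (+ 1 + + 2 * w) (+ 1)))
                   (sym (sqNorm-⟨m*u,t⟩ D m (t + + 2 * w′) t))
          (ι-mono-≤ (+≤+ (ℕ.*-monoʳ-≤ (minkowskiWeight D)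
            (subst (λ a → form m (∣ D ∣) a 1 ℕ.≤ form m (∣ D ∣) (∣ t + + 2 * w′ ∣) (∣ t ∣))
                   (sym ∣u∣≡1)
                   (form-min {m} {∣ D ∣} (∣ t + + 2 * w′ ∣) (∣ t ∣) m²≤∣D∣ ∣D∣≤3m² gapₜ gapᵤ)))))

    𝔞-hasWRIdeal : HasWRIdeal D
    𝔞-hasWRIdeal =
      𝔞 (+ m) , (𝔞-isIdeal {D} {+ m} {h} D≡ ω≡√D , v₊ , (+ 0 , + 1 , refl) , ⟨⟩≢0K (+ m * u₊)) ,
      v₊ , v₋ , 𝔞-minimal (+ 0) refl , 𝔞-minimal -[1+ 0 ] refl ,
      LinIndep-⟨⟩ (+ m * u₊) (+ 1) (+ m * u₋) (+ 1) det≢0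
      where
      u₊ = + 1 + + 2 * + 0
      u₋ = + 1 + + 2 * -[1+ 0 ]
      v₊ = ⟨ + m * u₊ , + 1 ⟩
      v₋ = ⟨ + m * u₋ , + 1 ⟩
      det≡2m : ∀ M → M * (+ 1 + + 2 * + 0) * + 1 - + 1 * (M * (+ 1 + + 2 * -[1+ 0 ]))
                   ≡ M + M
      det≡2m = solve-∀
      det≢0 : + m * u₊ * + 1 - + 1 * (+ m * u₋) ≢ + 0
      det≢0 det≡0 =
        ℕ.≢-nonZero⁻¹ m (ℕ.m+n≡0⇒m≡0 m (ℤ.+-injective (trans (sym (det≡2m (+ m))) det≡0)))

module QuadraticFieldFamilies where

  open import Defs
  open IntegralPoints
  open WellRoundedIdeal
  open Offset
  open SquareFreeOddPairs using (oddPair)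
  open import Data.Nat using (suc; _+_; _*_; _≤_; s≤s; _%_)
  import Data.Nat.Properties as ℕ
  open import Data.Nat.DivMod using ([m+kn]%n≡m%n)
  open import Data.Nat.Tactic.RingSolver using (solve)
  open import Data.Integer as ℤ using (+_; _%ℕ_)
  import Data.Integer.Properties as ℤ
  open import Data.Integer.Tactic.RingSolver using (solve-∀)
  open import Data.List using ([]; _∷_)
  open import Relation.Binary.PropositionalEquality

  ω≡√D : ∀ D → D %ℕ 4 ≡ 3 → ω D ≡ ⟨ + 0 , + 1 ⟩
  ω≡√D D D%4≡3 rewrite D%4≡3 = refl

  -P%ℕ4≡3 : ∀ P → P % 4 ≡ 1 → (ℤ.- + P) %ℕ 4 ≡ 3
  -P%ℕ4≡3 (suc k) P%4≡1 rewrite P%4≡1 = refl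

  2≤oddPair : ∀ q → 2 ≤ oddPair 1 q
  2≤oddPair q = ≤-offset (4 * q * q + 8 * q + 1) 2+slack≡d
    where
    2+slack≡d : 2 + (4 * q * q + 8 * q + 1) ≡ suc (2 * q) * suc (2 * (q + 1))
    2+slack≡d = solve (q ∷ [])

  real-hasWRIdeal : ∀ q → HasWRIdeal (+ oddPair 1 q)
  real-hasWRIdeal q = 𝔞-hasWRIdeal m (+ 1) D≡ (ω≡√D (+ d) d%4≡3) m²≤d d≤3m²
    where
    m = suc (2 * q)
    d = m * suc (2 * (q + 1))
    m+2≡ : suc (2 * (q + 1)) ≡ m + 2
    m+2≡ = cong suc (ℕ.*-distribˡ-+ 2 q 1)
    D≡ : + d ≡ + m ℤ.* (+ m ℤ.+ + 2 ℤ.* + 1)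
    D≡ = trans (cong (λ x → + (m * x)) m+2≡) (ℤ.pos-* m (m + 2))
    d%4≡3 : d % 4 ≡ 3
    d%4≡3 = trans (cong (_% 4) d≡3+4k) ([m+kn]%n≡m%n 3 (q * q + 2 * q) 4)
      where
      d≡3+4k : suc (2 * q) * suc (2 * (q + 1)) ≡ 3 + (q * q + 2 * q) * 4
      d≡3+4k = solve (q ∷ [])
    m²≤d : m * m ≤ d
    m²≤d = ℕ.*-monoʳ-≤ m (s≤s (ℕ.*-monoʳ-≤ 2 (ℕ.m≤m+n q 1)))
    d≤3m² : d ≤ 3 * (m * m)
    d≤3m² = ≤-offset (8 * q * q + 4 * q) d+slack≡3m²
      where
      d+slack≡3m² : suc (2 * q) * suc (2 * (q + 1)) + (8 * q * q + 4 * q) ≡ 3 * (suc (2 * q) * suc (2 * q))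
      d+slack≡3m² = solve (q ∷ [])

  imaginary-hasWRIdeal : ∀ q → HasWRIdeal (ℤ.- + oddPair 2 (suc q))
  imaginary-hasWRIdeal q = 𝔞-hasWRIdeal m h D≡ (ω≡√D D (-P%ℕ4≡3 P P%4≡1)) m²≤P P≤3m²
    where
    m = suc (2 * suc q)
    P = m * suc (2 * (suc q + 2))
    D = ℤ.- + P
    h = ℤ.- (+ m ℤ.+ + 2)
    m+4≡ : suc (2 * (suc q + 2)) ≡ m + 4
    m+4≡ = cong suc (ℕ.*-distribˡ-+ 2 (suc q) 2)
    D≡ : D ≡ + m ℤ.* (+ m ℤ.+ + 2 ℤ.* h)
    D≡ = trans (cong ℤ.-_ (trans (cong (λ x → + (m * x)) m+4≡) (ℤ.pos-* m (m + 4)))) (regroup (+ m))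
      where
      regroup : ∀ M → ℤ.- (M ℤ.* (M ℤ.+ + 4)) ≡ M ℤ.* (M ℤ.+ + 2 ℤ.* ℤ.- (M ℤ.+ + 2))
      regroup = solve-∀
    P%4≡1 : P % 4 ≡ 1
    P%4≡1 = trans (cong (_% 4) P≡1+4k) ([m+kn]%n≡m%n 1 (q * q + 5 * q + 5) 4)
      where
      P≡1+4k : suc (2 * suc q) * suc (2 * (suc q + 2)) ≡ 1 + (q * q + 5 * q + 5) * 4
      P≡1+4k = solve (q ∷ [])
    m²≤P : m * m ≤ P
    m²≤P = ℕ.*-monoʳ-≤ m (s≤s (ℕ.*-monoʳ-≤ 2 (ℕ.m≤m+n (suc q) 2)))
    P≤3m² : P ≤ 3 * (m * m)
    P≤3m² = ≤-offset (8 * q * q + 16 * q + 6) P+slack≡3m²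
      where
      P+slack≡3m² : suc (2 * suc q) * suc (2 * (suc q + 2)) + (8 * q * q + 16 * q + 6)
                    ≡ 3 * (suc (2 * suc q) * suc (2 * suc q))
      P+slack≡3m² = solve (q ∷ [])


open import Defs
open import Data.Nat using (ℕ; _<_; _≤_)
open import Data.Integer using (+_; -[1+_])
open import Data.Product using (_×_; ∃-syntax)

open import Data.Nat using (zero; suc; _*_)
open import Data.Nat.Properties using (<-trans; <-≤-trans; ≤-pred)
open import Data.Nat.Coprimality using (1-coprimeTo)
open import Data.Product using (_,_)
open OddSquareSieve using (2⊥odd)
open SquareFreeOddPairs using (oddPair; q<oddPair; squarefree-odd-pairs)
open QuadraticFieldFamilies using (2≤oddPair; real-hasWRIdeal; imaginary-hasWRIdeal)

theorem1p1 : ((N : ℕ) → ∃[ d ] (N < d × 2 ≤ d × SquareFree (+ d) × HasWRIdeal (+ d)))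
           × ((N : ℕ) → ∃[ k ] (N < k × SquareFree -[1+ k ] × HasWRIdeal -[1+ k ]))
theorem1p1 = real , imaginary
  where
  real : (N : ℕ) → ∃[ d ] (N < d × 2 ≤ d × SquareFree (+ d) × HasWRIdeal (+ d))
  real N = field-of (squarefree-odd-pairs 1 (λ y → 1-coprimeTo (suc (2 * y))) N)
    where
    field-of : ∃[ q ] (N < q × SquareFree (+ oddPair 1 q)) →
               ∃[ d ] (N < d × 2 ≤ d × SquareFree (+ d) × HasWRIdeal (+ d))
    field-of (q , N<q , sf) = oddPair 1 q , <-trans N<q (q<oddPair 1 q) , 2≤oddPair q , sf , real-hasWRIdeal q
  imaginary : (N : ℕ) → ∃[ k ] (N < k × SquareFree -[1+ k ] × HasWRIdeal -[1+ k ])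
  imaginary N = field-of (squarefree-odd-pairs 2 2⊥odd N)
    where
    field-of : ∃[ q ] (N < q × SquareFree (+ oddPair 2 q)) →
               ∃[ k ] (N < k × SquareFree -[1+ k ] × HasWRIdeal -[1+ k ])
    field-of (zero  , ()  , _)
    field-of (suc q , N<q , sf) =
      _ , <-≤-trans N<q (≤-pred (q<oddPair 2 (suc q))) , sf , imaginary-hasWRIdeal q
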